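{- Let $\pi$ and $\tau$ be skew-merged permutations. Suppose that $e$ is a type-preserving embedding of the non-central elements of $\pi$ into $\tau$, $f$ is a type-preserving map from the non-central elements of $\pi$ into $\tau$, and $f(x)\unlhd e(x)$ for every non-central $x\in\pi$. Then for every non-central $x\in\pi$, \[\mathit{inner}\{ f(x^{oh})^{ih}_{T(x)},\ f(x^{ov})^{iv}_{T(x)}\}\unlhd e(x).\]
   Context: A permutation is a set of points $(i,\pi(i))$; an embedding is an injective map on points preserving relative horizontal and vertical order of every pair. A skew-merged permutation is one whose points split into an increasing and a decreasing subsequence. An element has type NE if it is the $3$ in an occurrence of $213$; NW if it is the $3$ in an occurrence of $312$; SW if it is the $1$ in an occurrence of $132$; SE if it is the $1$ in an occurrence of $231$; central otherwise. $T(x)$ denotes the type of a non-central element; types NW, SW form the west half, NE, SE the east half, NW, NE the north half, SW, SE the south half. "Type-preserving" means each non-central element is sent to an element of the same type. For same-type elements, $x\lhd y$ means $x\ne y$ and $x$ is further from the centre than $y$ (SW: below-left; NE: above-right; NW: above-left; SE: below-right); $x\unlhd y$ means $x\lhd y$ or $x=y$; $\mathit{inner}$ is the $\lhd$-maximum. For a non-central element $x$ (in either permutation): $x^{oh}$ is the next non-central element further out horizontally (the nearest non-central element to the left if $x$ is in the west half, to the right if in the east half); $x^{ih}$ is the next non-central element of the same horizontal half towards the centre (nearest to the right if west, to the left if east); $x^{ov}$ is the next non-central element further out vertically (nearest above if north, below if south); $x^{iv}$ is the next non-central element of the same vertical half towards the centre (nearest below if north, above if south). For a direction $a\in\{oh,ih,ov,iv\}$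 and type $b$, $x^a_b$ is the first element of type $b$ in the sequence $x^a,(x^a)^a,\dots$. Undefined values are $\bot$, and any operator applied to $\bot$ gives $\bot$; $\bot$ arguments are ignored in $\mathit{inner}$ and if both are $\bot$ the inequality is considered to hold trivially. -}

module Defs where

open import Data.Nat using (ℕ)
open import Data.Fin using (Fin; _<_)
open import Data.Bool using (Bool; true; false)
open import Data.Product using (Σ; ∃; ∃-syntax; _×_; _,_; proj₁)
open import Data.Sum using (_⊎_)
open import Relation.Nullary using (¬_)
open import Relation.Binary.PropositionalEquality using (_≡_; _≢_)
open import Function.Definitions using (Injective)

record Perm (n : ℕ) : Set where
  field
    val : Fin n → Fin n
    inj : Injective _≡_ _≡_ val
open Perm public

SkewMerged : ∀ {n} → Perm n → Set
SkewMerged {n} π = Σ (Fin n → Bool) λ c →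
  (∀ i j → i < j → c i ≡ true → c j ≡ true → val π i < val π j) ×
  (∀ i j → i < j → c i ≡ false → c j ≡ false → val π j < val π i)

data Ty : Set where
  NE NW SW SE : Ty

HasType : ∀ {n} → Perm n → Fin n → Ty → Set
-- NE: x is the 3 of a 213 (positions i < j < x)
HasType {n} π x NE = ∃[ i ] ∃[ j ] (i < j × j < x × val π j < val π i × val π i < val π x)
-- NW: x is the 3 of a 312 (positions x < i < j)
HasType {n} π x NW = ∃[ i ] ∃[ j ] (x < i × i < j × val π i < val π j × val π j < val π x)
-- SW: x is the 1 of a 132 (positions x < i < j)
HasType {n} π x SW = ∃[ i ] ∃[ j ] (x < i × i < j × val π x < val π j × val π j < val π i)
-- SE: x is the 1 of a 231 (positions i < j < x)
HasType {n} π x SE = ∃[ i ] ∃[ j ] (i < j × j < x × val π x < val π i × val π i < val π j)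

NonCentral : ∀ {n} → Perm n → Fin n → Set
NonCentral π x = ∃[ t ] HasType π x t

NC : ∀ {n} → Perm n → Set
NC {n} π = Σ (Fin n) (NonCentral π)

West East North South : ∀ {n} → Perm n → Fin n → Set
West π x = HasType π x NW ⊎ HasType π x SW
East π x = HasType π x NE ⊎ HasType π x SE
North π x = HasType π x NW ⊎ HasType π x NE
South π x = HasType π x SW ⊎ HasType π x SE

Further : ∀ {n} → Perm n → Ty → Fin n → Fin n → Set
Further π SW x y = x ≢ y × x < y × val π x < val π y
Further π NE x y = x ≢ y × y < x × val π y < val π x
Further π NW x y = x ≢ y × x < y × val π y < val π x
Further π SE x y = x ≢ y × y < x × val π x < val π y

Unlhd : ∀ {n} → Perm n → Ty → Fin n → Fin n → Set
Unlhd π t x y = Further π t x y ⊎ x ≡ y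

LeftNearest RightNearest AboveNearest BelowNearest :
  ∀ {n} → Perm n → (Fin n → Set) → Fin n → Fin n → Set
LeftNearest π P y z = P z × z < y × (∀ w → P w → z < w → ¬ (w < y))
RightNearest π P y z = P z × y < z × (∀ w → P w → y < w → ¬ (w < z))
AboveNearest π P y z =
  P z × val π y < val π z × (∀ w → P w → val π y < val π w → ¬ (val π w < val π z))
BelowNearest π P y z =
  P z × val π z < val π y × (∀ w → P w → val π w < val π y → ¬ (val π z < val π w))

data Dir : Set where
  oh ih ov iv : Dir

Step : ∀ {n} → Dir → Perm n → Fin n → Fin n → Set
Step oh π y z = (West π y × LeftNearest π (NonCentral π) y z)
              ⊎ (East π y × RightNearest π (NonCentral π) y z)
Step ih π y z = (West π y × RightNearest π (West π) y z)
              ⊎ (East π y × LeftNearest π (East π) y z)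
Step ov π y z = (North π y × AboveNearest π (NonCentral π) y z)
              ⊎ (South π y × BelowNearest π (NonCentral π) y z)
Step iv π y z = (North π y × BelowNearest π (North π) y z)
              ⊎ (South π y × AboveNearest π (South π) y z)

-- Iter a π b y z : z = y^a_b, the first element of type b in y^a, (y^a)^a, ...
data Iter {n} (a : Dir) (π : Perm n) (b : Ty) : Fin n → Fin n → Set where
  found : ∀ {y w} → Step a π y w → HasType π w b → Iter a π b y w
  skip  : ∀ {y w z} → Step a π y w → ¬ HasType π w b → Iter a π b w z → Iter a π b y z

Embedding : ∀ {n m} (π : Perm n) (τ : Perm m) → (NC π → Fin m) → Set
Embedding π τ g = ∀ (p q : NC π) →
  (g p ≡ g q → proj₁ p ≡ proj₁ q) ×
  (proj₁ p < proj₁ q → g p < g q) ×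
  (val π (proj₁ p) < val π (proj₁ q) → val τ (g p) < val τ (g q))

TypePreserving : ∀ {n m} (π : Perm n) (τ : Perm m) → (NC π → Fin m) → Set
TypePreserving π τ g = ∀ (p : NC π) t → HasType π (proj₁ p) t → HasType τ (g p) t

-- the (at most two) defined values among
-- f(x^oh)^ih_t and f(x^ov)^iv_t, as a predicate on elements of τ
Cand : ∀ {n m} (π : Perm n) (τ : Perm m) → (NC π → Fin m) → Ty → Fin n → Fin m → Set
Cand π τ f t x w =
  (∃[ q ] (Step oh π x (proj₁ q) × Iter ih τ t (f q) w)) ⊎
  (∃[ q ] (Step ov π x (proj₁ q) × Iter iv τ t (f q) w))

IsInner : ∀ {m} → Perm m → Ty → (Fin m → Set) → Fin m → Set
IsInner τ t S z = S z × (∀ w → S w → Unlhd τ t w z)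

-- Each candidate arises by stepping out from x to its neighbour x' along one axis
-- (horizontal: oh then ih, vertical: ov then iv), applying f, and walking back
-- towards the centre to the first element of type T(x); every candidate, not only
-- the inner one, is ⊴ e(x).  Since e embeds, e(x') lies strictly outward of e(x)
-- along that axis, and f(x') ⊴ e(x') puts f(x') at least as far out, so e(x), of
-- type T(x), lies ahead on the walk and the walk stops no later than at e(x).
-- Skew-mergedness supplies the two facts this needs: every element has a unique
-- type (so the halves are disjoint and the walks stay in one half), and the
-- elements of one type form a monotone chain (so comparing them along one axis
-- already decides ⊲).
module Submission where

open import Defs
open import Data.Bool using (Bool; true; false; not)
open import Data.Empty using (⊥; ⊥-elim)
open import Data.Fin using (Fin; _<_)
open import Data.Fin.Properties using (<-irrefl; <-asym; <-trans; <-cmp)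
open import Data.Product using (∃-syntax; _×_; _,_; proj₁; proj₂)
open import Data.Sum using (_⊎_; inj₁; inj₂)
open import Function using (id; flip; _∘′_)
open import Relation.Binary.Definitions using (tri<; tri≈; tri>)
open import Relation.Binary.PropositionalEquality
  using (_≡_; _≢_; refl; sym; trans; cong; subst)
open import Relation.Nullary using (¬_; contradiction)

data Axis : Set where
  horizontal vertical : Axis

orthogonal : Axis → Axis
orthogonal horizontal = vertical
orthogonal vertical   = horizontal

data Sense : Set where
  ascending descending : Sense

Before : ∀ {n} → Sense → Fin n → Fin n → Set
Before ascending  = _<_
Before descending = flip _<_

Before-trans : ∀ {n s} {i j k : Fin n} → Before s i j → Before s j k → Before s i k
Before-trans {s = ascending}  p q = <-trans p q
Before-trans {s = descending} p q = <-trans q p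

Before-irrefl : ∀ {n s} {i : Fin n} → ¬ Before s i i
Before-irrefl {s = ascending}  {i} = <-irrefl {x = i} refl
Before-irrefl {s = descending} {i} = <-irrefl {x = i} refl

Before-trichotomous : ∀ {n} s (i j : Fin n) → Before s i j ⊎ i ≡ j ⊎ Before s j i
Before-trichotomous ascending i j with <-cmp i j
... | tri< p _ _ = inj₁ p
... | tri≈ _ q _ = inj₂ (inj₁ q)
... | tri> _ _ r = inj₂ (inj₂ r)
Before-trichotomous descending i j with <-cmp i j
... | tri< p _ _ = inj₂ (inj₂ p)
... | tri≈ _ q _ = inj₂ (inj₁ q)
... | tri> _ _ r = inj₁ r

coord : ∀ {n} → Axis → Perm n → Fin n → Fin n
coord horizontal π = id
coord vertical   π = val π

Precedes : ∀ {n} → Perm n → Axis → Sense → Fin n → Fin n → Set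
Precedes π ax s y z = Before s (coord ax π y) (coord ax π z)

centreward : Axis → Ty → Sense
centreward horizontal NW = ascending
centreward horizontal SW = ascending
centreward horizontal NE = descending
centreward horizontal SE = descending
centreward vertical   SW = ascending
centreward vertical   SE = ascending
centreward vertical   NW = descending
centreward vertical   NE = descending

-- The half of π whose types move centreward in sense s along ax.
Half : ∀ {n} → Perm n → Axis → Sense → Fin n → Set
Half π horizontal ascending  = West π
Half π horizontal descending = East π
Half π vertical   ascending  = South π
Half π vertical   descending = North π

inwardDir outwardDir : Axis → Dir
inwardDir horizontal  = ih
inwardDir vertical    = iv
outwardDir horizontal = oh
outwardDir vertical   = ov

colour : Ty → Bool
colour NE = true
colour SW = true
colour NW = false
colour SE = false

InnerQuadrant : ∀ {n} → Perm n → Ty → Fin n → Fin n → Set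
InnerQuadrant π t x k =
  Precedes π horizontal (centreward horizontal t) x k ×
  Precedes π vertical (centreward vertical t) x k

record FirstOfType {n} (π : Perm n) (ax : Axis) (t : Ty) (y w : Fin n) : Set where
  field
    type     : HasType π w t
    half     : Half π ax (centreward ax t) y
    precedes : Precedes π ax (centreward ax t) y w
    first    : ∀ u → HasType π u t → Precedes π ax (centreward ax t) y u →
               ¬ Precedes π ax (centreward ax t) u w

module PermProperties {n} (π : Perm n) where

  coord-injective : ∀ ax {y z} → coord ax π y ≡ coord ax π z → y ≡ z
  coord-injective horizontal = id
  coord-injective vertical   = inj π

  Precedes-trans : ∀ ax {s} {x y z : Fin n} →
    Precedes π ax s x y → Precedes π ax s y z → Precedes π ax s x z
  Precedes-trans ax {s} = Before-trans {s = s}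

  Precedes⇒≢ : ∀ ax {s} {y z : Fin n} → Precedes π ax s y z → y ≢ z
  Precedes⇒≢ ax {s} {y} p refl = Before-irrefl {s = s} {coord ax π y} p

  Precedes-trichotomous : ∀ ax s (y z : Fin n) →
    Precedes π ax s y z ⊎ y ≡ z ⊎ Precedes π ax s z y
  Precedes-trichotomous ax s y z
    with Before-trichotomous s (coord ax π y) (coord ax π z)
  ... | inj₁ p         = inj₁ p
  ... | inj₂ (inj₁ eq) = inj₂ (inj₁ (coord-injective ax eq))
  ... | inj₂ (inj₂ p)  = inj₂ (inj₂ p)

  type⇒Half : ∀ ax {t x} → HasType π x t → Half π ax (centreward ax t) x
  type⇒Half horizontal {NW} h = inj₁ h
  type⇒Half horizontal {SW} h = inj₂ h
  type⇒Half horizontal {NE} h = inj₁ h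
  type⇒Half horizontal {SE} h = inj₂ h
  type⇒Half vertical   {NW} h = inj₁ h
  type⇒Half vertical   {SW} h = inj₁ h
  type⇒Half vertical   {NE} h = inj₂ h
  type⇒Half vertical   {SE} h = inj₂ h

  Half⇒type : ∀ {ax s x} → Half π ax s x → ∃[ t ] (HasType π x t × centreward ax t ≡ s)
  Half⇒type {horizontal} {ascending}  (inj₁ h) = NW , h , refl
  Half⇒type {horizontal} {ascending}  (inj₂ h) = SW , h , refl
  Half⇒type {horizontal} {descending} (inj₁ h) = NE , h , refl
  Half⇒type {horizontal} {descending} (inj₂ h) = SE , h , refl
  Half⇒type {vertical}   {ascending}  (inj₁ h) = SW , h , refl
  Half⇒type {vertical}   {ascending}  (inj₂ h) = SE , h , refl
  Half⇒type {vertical}   {descending} (inj₁ h) = NW , h , refl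
  Half⇒type {vertical}   {descending} (inj₂ h) = NE , h , refl

  Further⇒Precedes² : ∀ {t u w} → Further π t u w →
    Precedes π horizontal (centreward horizontal t) u w ×
    Precedes π vertical (centreward vertical t) u w
  Further⇒Precedes² {NE} (_ , p , q) = p , q
  Further⇒Precedes² {NW} (_ , p , q) = p , q
  Further⇒Precedes² {SW} (_ , p , q) = p , q
  Further⇒Precedes² {SE} (_ , p , q) = p , q

  Precedes²⇒Further : ∀ {t u w} → u ≢ w →
    Precedes π horizontal (centreward horizontal t) u w →
    Precedes π vertical (centreward vertical t) u w → Further π t u w
  Precedes²⇒Further {NE} u≢w p q = u≢w , p , q
  Precedes²⇒Further {NW} u≢w p q = u≢w , p , q
  Precedes²⇒Further {SW} u≢w p q = u≢w , p , q
  Precedes²⇒Further {SE} u≢w p q = u≢w , p , q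

  Further⇒Precedes : ∀ ax {t u w} → Further π t u w → Precedes π ax (centreward ax t) u w
  Further⇒Precedes horizontal = proj₁ ∘′ Further⇒Precedes²
  Further⇒Precedes vertical   = proj₂ ∘′ Further⇒Precedes²

module SkewMergedProperties {n} (π : Perm n) (sm : SkewMerged π) where

  open PermProperties π

  private
    c : Fin n → Bool
    c = proj₁ sm

    v : Fin n → Fin n
    v = val π

  increasing : ∀ {i j} → c i ≡ true → c j ≡ true → i < j → v i < v j
  increasing ci cj i<j = proj₁ (proj₂ sm) _ _ i<j ci cj

  decreasing : ∀ {i j} → c i ≡ false → c j ≡ false → i < j → v j < v i
  decreasing ci cj i<j = proj₂ (proj₂ sm) _ _ i<j ci cj

  increasing⁻¹ : ∀ {i j} → c i ≡ true → c j ≡ true → v i < v j → i < j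
  increasing⁻¹ {i} {j} ci cj vi<vj with <-cmp i j
  ... | tri< i<j _ _ = i<j
  ... | tri≈ _ refl _ = contradiction vi<vj (<-irrefl refl)
  ... | tri> _ _ j<i = contradiction (increasing cj ci j<i) (<-asym vi<vj)

  decreasing⁻¹ : ∀ {i j} → c i ≡ false → c j ≡ false → v i < v j → j < i
  decreasing⁻¹ {i} {j} ci cj vi<vj with <-cmp i j
  ... | tri< i<j _ _ = contradiction (decreasing ci cj i<j) (<-asym vi<vj)
  ... | tri≈ _ refl _ = contradiction vi<vj (<-irrefl refl)
  ... | tri> _ _ j<i = j<i

  descent-meets-false : (Q : Fin n → Set) → ∀ {i j} → Q i → Q j → i < j → v j < v i →
    ∃[ k ] (c k ≡ false × Q k)
  descent-meets-false Q {i} {j} qi qj i<j vj<vi with c i in ci | c j in cj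
  ... | false | _     = i , ci , qi
  ... | true  | false = j , cj , qj
  ... | true  | true  = contradiction (increasing ci cj i<j) (<-asym vj<vi)

  ascent-meets-true : (Q : Fin n → Set) → ∀ {i j} → Q i → Q j → i < j → v i < v j →
    ∃[ k ] (c k ≡ true × Q k)
  ascent-meets-true Q {i} {j} qi qj i<j vi<vj with c i in ci | c j in cj
  ... | true  | _     = i , ci , qi
  ... | false | true  = j , cj , qj
  ... | false | false = contradiction (decreasing ci cj i<j) (<-asym vi<vj)

  -- The pattern occurrence witnessing type t lies in the inner quadrant of x and
  -- runs against the monotonicity of colour t, so one of its points has the other colour.
  inner-witness : ∀ {t x} → HasType π x t → ∃[ k ] (c k ≡ not (colour t) × InnerQuadrant π t x k)
  inner-witness {NE} (i , j , i<j , j<x , vj<vi , vi<vx) =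
    descent-meets-false (InnerQuadrant π NE _)
      (<-trans i<j j<x , vi<vx) (j<x , <-trans vj<vi vi<vx) i<j vj<vi
  inner-witness {SW} (i , j , x<i , i<j , vx<vj , vj<vi) =
    descent-meets-false (InnerQuadrant π SW _)
      (x<i , <-trans vx<vj vj<vi) (<-trans x<i i<j , vx<vj) i<j vj<vi
  inner-witness {NW} (i , j , x<i , i<j , vi<vj , vj<vx) =
    ascent-meets-true (InnerQuadrant π NW _)
      (x<i , <-trans vi<vj vj<vx) (<-trans x<i i<j , vj<vx) i<j vi<vj
  inner-witness {SE} (i , j , i<j , j<x , vx<vi , vi<vj) =
    ascent-meets-true (InnerQuadrant π SE _)
      (<-trans i<j j<x , vx<vi) (j<x , <-trans vx<vi vi<vj) i<j vi<vj

  type-colour : ∀ t {x} → HasType π x t → c x ≡ colour t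
  type-colour NE {x} h with inner-witness {NE} h | c x in cx
  ... | _ | true = refl
  ... | k , ck , k<x , vk<vx | false = contradiction (decreasing ck cx k<x) (<-asym vk<vx)
  type-colour SW {x} h with inner-witness {SW} h | c x in cx
  ... | _ | true = refl
  ... | k , ck , x<k , vx<vk | false = contradiction (decreasing cx ck x<k) (<-asym vx<vk)
  type-colour NW {x} h with inner-witness {NW} h | c x in cx
  ... | _ | false = refl
  ... | k , ck , x<k , vk<vx | true = contradiction (increasing cx ck x<k) (<-asym vk<vx)
  type-colour SE {x} h with inner-witness {SE} h | c x in cx
  ... | _ | false = refl
  ... | k , ck , k<x , vx<vk | true = contradiction (increasing ck cx k<x) (<-asym vx<vk)

  NE-SW-disjoint : ∀ {x} → HasType π x NE → HasType π x SW → ⊥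
  NE-SW-disjoint ne sw with inner-witness {NE} ne | inner-witness {SW} sw
  ... | k , ck , k<x , vk<vx | l , cl , x<l , vx<vl =
    <-asym (<-trans vk<vx vx<vl) (decreasing ck cl (<-trans k<x x<l))

  NW-SE-disjoint : ∀ {x} → HasType π x NW → HasType π x SE → ⊥
  NW-SE-disjoint nw se with inner-witness {NW} nw | inner-witness {SE} se
  ... | k , ck , x<k , vk<vx | l , cl , l<x , vx<vl =
    <-asym (<-trans vk<vx vx<vl) (increasing cl ck (<-trans l<x x<k))

  type-unique : ∀ {x t₁ t₂} → HasType π x t₁ → HasType π x t₂ → t₁ ≡ t₂
  type-unique {t₁ = t₁} {t₂} h₁ h₂ =
    go t₁ t₂ (trans (sym (type-colour t₁ h₁)) (type-colour t₂ h₂)) h₁ h₂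
    where
    go : ∀ {x} t₁ t₂ → colour t₁ ≡ colour t₂ → HasType π x t₁ → HasType π x t₂ → t₁ ≡ t₂
    go NE NE _ _  _  = refl
    go SW SW _ _  _  = refl
    go NW NW _ _  _  = refl
    go SE SE _ _  _  = refl
    go NE SW _ h₁ h₂ = ⊥-elim (NE-SW-disjoint h₁ h₂)
    go SW NE _ h₁ h₂ = ⊥-elim (NE-SW-disjoint h₂ h₁)
    go NW SE _ h₁ h₂ = ⊥-elim (NW-SE-disjoint h₁ h₂)
    go SE NW _ h₁ h₂ = ⊥-elim (NW-SE-disjoint h₂ h₁)
    go NE NW ()
    go NE SE ()
    go SW NW ()
    go SW SE ()
    go NW NE ()
    go NW SW ()
    go SE NE ()
    go SE SW ()

  centreward-Half : ∀ {ax s t y} → HasType π y t → Half π ax s y → centreward ax t ≡ s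
  centreward-Half {ax} h hh with Half⇒type {ax = ax} hh
  ... | t′ , h′ , refl = cong (centreward ax) (type-unique h h′)

  Half-unique : ∀ {ax s s′ y} → Half π ax s y → Half π ax s′ y → s ≡ s′
  Half-unique {ax} h₁ h₂ with Half⇒type {ax = ax} h₁
  ... | t , h , refl = centreward-Half h h₂

  opposite-halves : ∀ ax {y} → Half π ax ascending y → Half π ax descending y → ⊥
  opposite-halves ax h₁ h₂ with Half-unique {ax} h₁ h₂
  ... | ()

  Precedes-orthogonal : ∀ ax {t u w} → HasType π u t → HasType π w t →
    Precedes π ax (centreward ax t) u w →
    Precedes π (orthogonal ax) (centreward (orthogonal ax) t) u w
  Precedes-orthogonal horizontal {NE} hu hw p = increasing (type-colour NE hw) (type-colour NE hu) p
  Precedes-orthogonal horizontal {SW} hu hw p = increasing (type-colour SW hu) (type-colour SW hw) p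
  Precedes-orthogonal horizontal {NW} hu hw p = decreasing (type-colour NW hu) (type-colour NW hw) p
  Precedes-orthogonal horizontal {SE} hu hw p = decreasing (type-colour SE hw) (type-colour SE hu) p
  Precedes-orthogonal vertical   {NE} hu hw p = increasing⁻¹ (type-colour NE hw) (type-colour NE hu) p
  Precedes-orthogonal vertical   {SW} hu hw p = increasing⁻¹ (type-colour SW hu) (type-colour SW hw) p
  Precedes-orthogonal vertical   {NW} hu hw p = decreasing⁻¹ (type-colour NW hw) (type-colour NW hu) p
  Precedes-orthogonal vertical   {SE} hu hw p = decreasing⁻¹ (type-colour SE hu) (type-colour SE hw) p

  Precedes⇒Further : ∀ ax {t u w} → HasType π u t → HasType π w t →
    Precedes π ax (centreward ax t) u w → Further π t u w
  Precedes⇒Further horizontal {t} hu hw p =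
    Precedes²⇒Further (Precedes⇒≢ horizontal {centreward horizontal t} p) p
      (Precedes-orthogonal horizontal hu hw p)
  Precedes⇒Further vertical {t} hu hw p =
    Precedes²⇒Further (Precedes⇒≢ vertical {centreward vertical t} p)
      (Precedes-orthogonal vertical hu hw p) p

  Unlhd⇒Precedes : ∀ {ax s t y y′} → HasType π y t → Half π ax s y → Unlhd π t y y′ →
    Precedes π ax s y y′ ⊎ y ≡ y′
  Unlhd⇒Precedes {ax} {t = t} {y} {y′} h hh (inj₁ y⊲y′) =
    inj₁ (subst (λ s → Precedes π ax s y y′) (centreward-Half {ax} {t = t} h hh)
                (Further⇒Precedes ax y⊲y′))
  Unlhd⇒Precedes h hh (inj₂ y≡y′) = inj₂ y≡y′

  outward-step : ∀ {ax s x q} → Half π ax s x → Step (outwardDir ax) π x q → Precedes π ax s q x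
  outward-step {horizontal} {ascending}  _  (inj₁ (_ , _ , q<x , _)) = q<x
  outward-step {horizontal} {ascending}  hx (inj₂ (hx′ , _))         = ⊥-elim (opposite-halves horizontal hx hx′)
  outward-step {horizontal} {descending} hx (inj₁ (hx′ , _))         = ⊥-elim (opposite-halves horizontal hx′ hx)
  outward-step {horizontal} {descending} _  (inj₂ (_ , _ , x<q , _)) = x<q
  outward-step {vertical}   {ascending}  hx (inj₁ (hx′ , _))         = ⊥-elim (opposite-halves vertical hx hx′)
  outward-step {vertical}   {ascending}  _  (inj₂ (_ , _ , q<x , _)) = q<x
  outward-step {vertical}   {descending} _  (inj₁ (_ , _ , x<q , _)) = x<q
  outward-step {vertical}   {descending} hx (inj₂ (hx′ , _))         = ⊥-elim (opposite-halves vertical hx′ hx)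

  inward-step : ∀ ax {s y z} → Half π ax s z → Step (inwardDir ax) π y z →
    Half π ax s y × Precedes π ax s y z ×
    (∀ u → Half π ax s u → Precedes π ax s y u → ¬ Precedes π ax s u z)
  inward-step horizontal {ascending}  _  (inj₁ (hy , _ , p , near)) = hy , p , near
  inward-step horizontal {ascending}  hz (inj₂ (_ , hz′ , _))       = ⊥-elim (opposite-halves horizontal hz hz′)
  inward-step horizontal {descending} hz (inj₁ (_ , hz′ , _))       = ⊥-elim (opposite-halves horizontal hz′ hz)
  inward-step horizontal {descending} _  (inj₂ (hy , _ , p , near)) = hy , p , λ u hu p₁ p₂ → near u hu p₂ p₁
  inward-step vertical   {ascending}  hz (inj₁ (_ , hz′ , _))       = ⊥-elim (opposite-halves vertical hz hz′)
  inward-step vertical   {ascending}  _  (inj₂ (hy , _ , p , near)) = hy , p , near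
  inward-step vertical   {descending} _  (inj₁ (hy , _ , p , near)) = hy , p , near
  inward-step vertical   {descending} hz (inj₂ (_ , hz′ , _))       = ⊥-elim (opposite-halves vertical hz′ hz)

  FirstOfType-step : ∀ {ax t y w} → Step (inwardDir ax) π y w → HasType π w t →
    FirstOfType π ax t y w
  FirstOfType-step {ax} {t} step hw with inward-step ax (type⇒Half ax {t} hw) step
  ... | hy , y≺w , near = record
    { type = hw ; half = hy ; precedes = y≺w ; first = λ u hu → near u (type⇒Half ax {t} hu) }

  FirstOfType-skip : ∀ {ax t y y′ w} → Step (inwardDir ax) π y y′ → ¬ HasType π y′ t →
    FirstOfType π ax t y′ w → FirstOfType π ax t y w
  FirstOfType-skip {ax} {t} {y} {y′} {w} step ¬hy′ F with inward-step ax (FirstOfType.half F) step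
  ... | hy , y≺y′ , near = record
    { type     = type
    ; half     = hy
    ; precedes = Precedes-trans ax {centreward ax t} y≺y′ precedes
    ; first    = first′
    }
    where
    open FirstOfType F
    first′ : ∀ u → HasType π u t → Precedes π ax (centreward ax t) y u →
      ¬ Precedes π ax (centreward ax t) u w
    first′ u hu y≺u u≺w with Precedes-trichotomous ax (centreward ax t) u y′
    ... | inj₁ u≺y′        = near u (type⇒Half ax {t} hu) y≺u u≺y′
    ... | inj₂ (inj₁ refl) = ¬hy′ hu
    ... | inj₂ (inj₂ y′≺u) = first u hu y′≺u u≺w

  Iter⇒FirstOfType : ∀ {ax t y w} → Iter (inwardDir ax) π t y w → FirstOfType π ax t y w
  Iter⇒FirstOfType (found step hw)       = FirstOfType-step step hw
  Iter⇒FirstOfType (skip step ¬hy′ iter) = FirstOfType-skip step ¬hy′ (Iter⇒FirstOfType iter)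

  FirstOfType⇒⊴ : ∀ {ax t y w z} → FirstOfType π ax t y w → HasType π z t →
    Precedes π ax (centreward ax t) y z → Unlhd π t w z
  FirstOfType⇒⊴ {ax} {t} {w = w} {z} F hz y≺z with Precedes-trichotomous ax (centreward ax t) w z
  ... | inj₁ w≺z        = inj₁ (Precedes⇒Further ax (FirstOfType.type F) hz w≺z)
  ... | inj₂ (inj₁ w≡z) = inj₂ w≡z
  ... | inj₂ (inj₂ z≺w) = contradiction z≺w (FirstOfType.first F z hz y≺z)

Embedding⇒Precedes : ∀ {n m} {π : Perm n} {τ : Perm m} {e : NC π → Fin m} →
  Embedding π τ e → ∀ ax {s} {p q : NC π} →
  Precedes π ax s (proj₁ p) (proj₁ q) → Precedes τ ax s (e p) (e q)
Embedding⇒Precedes emb horizontal {ascending}  {p} {q} = proj₁ (proj₂ (emb p q))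
Embedding⇒Precedes emb horizontal {descending} {p} {q} = proj₁ (proj₂ (emb q p))
Embedding⇒Precedes emb vertical   {ascending}  {p} {q} = proj₂ (proj₂ (emb p q))
Embedding⇒Precedes emb vertical   {descending} {p} {q} = proj₂ (proj₂ (emb q p))

module _ {n m} {π : Perm n} {τ : Perm m} (smπ : SkewMerged π) (smτ : SkewMerged τ)
  {e f : NC π → Fin m} (emb : Embedding π τ e)
  (tpe : TypePreserving π τ e) (tpf : TypePreserving π τ f)
  (f⊴e : ∀ (p : NC π) t → HasType π (proj₁ p) t → Unlhd τ t (f p) (e p)) where

  private
    module P = SkewMergedProperties π smπ
    module T = SkewMergedProperties τ smτ
    open PermProperties

  candidate-⊴ : ∀ ax {t w} (p q : NC π) → HasType π (proj₁ p) t →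
    Step (outwardDir ax) π (proj₁ p) (proj₁ q) → Iter (inwardDir ax) τ t (f q) w →
    Unlhd τ t w (e p)
  candidate-⊴ ax {t} {w} p q@(_ , tq , hq) hp step iter =
    T.FirstOfType⇒⊴ F (tpe p t hp) fq≺ep
    where
    F : FirstOfType τ ax t (f q) w
    F = T.Iter⇒FirstOfType iter
    eq≺ep : Precedes τ ax (centreward ax t) (e q) (e p)
    eq≺ep = Embedding⇒Precedes emb ax {centreward ax t} {q} {p}
      (P.outward-step {ax} (type⇒Half π ax {t} hp) step)
    fq≺ep : Precedes τ ax (centreward ax t) (f q) (e p)
    fq≺ep with T.Unlhd⇒Precedes {ax} {t = tq} (tpf q tq hq) (FirstOfType.half F) (f⊴e q tq hq)
    ... | inj₁ fq≺eq = Precedes-trans τ ax {centreward ax t} fq≺eq eq≺ep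
    ... | inj₂ fq≡eq = subst (λ y → Precedes τ ax (centreward ax t) y (e p)) (sym fq≡eq) eq≺ep

proposition12 : ∀ {n m} (π : Perm n) (τ : Perm m) →
    SkewMerged π → SkewMerged τ →
    (e f : NC π → Fin m) →
    Embedding π τ e → TypePreserving π τ e → TypePreserving π τ f →
    (∀ (p : NC π) t → HasType π (proj₁ p) t → Unlhd τ t (f p) (e p)) →
    ∀ (p : NC π) t → HasType π (proj₁ p) t →
    ∀ z → IsInner τ t (Cand π τ f t (proj₁ p)) z → Unlhd τ t z (e p)
proposition12 π τ smπ smτ e f emb tpe tpf f⊴e p t hp z (inj₁ (q , step , iter) , _) =
  candidate-⊴ smπ smτ emb tpe tpf f⊴e horizontal p q hp step iter
proposition12 π τ smπ smτ e f emb tpe tpf f⊴e p t hp z (inj₂ (q , step , iter) , _) =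
  candidate-⊴ smπ smτ emb tpe tpf f⊴e vertical p q hp step iter
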